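{- Let $T$ be a tree with $n\ge1$ vertices and $\ell\ge 1$ an integer. For every integer $t\ge1$ and every $x\in tP_\ell(T)\cap\mathbb{Z}^n$, $x$ is a $t$-dilated configuration on $T$.
   Context: Label the vertices $v_1,\dots,v_n$. A chip configuration on $T$ is a vector $c\in\mathbb{Z}_{\ge 0}^n$ ($c_i$ chips on $v_i$); the number of chips on a subtree is the sum of entries over its vertices. The Laplacian $\Delta(T)$ has $\Delta_{ii}=\deg(v_i)$, $\Delta_{ij}=-1$ if $v_iv_j$ is an edge, $0$ otherwise. Firing $v_i$ from $c$ produces $c-\Delta(T)e_i$, legal if $c_i\ge\deg(v_i)$. A configuration $c$ is self-reachable on $T$ if some nonempty finite sequence of legal firings starting from $c$ ends at $c$. (Known: equivalently, $c$ has at least $m-1$ chips on every $m$-vertex subtree of $T$.) $S_\ell^{(T)}$ is the set of self-reachable configurations with exactly $\ell$ chips, $P_\ell(T)=\mathrm{conv}(S_\ell^{(T)})$, and $tP=\{tx:x\in P\}$. For $t\ge1$, a chip configuration is $t$-dilated on $T$ if it has at least $t(m-1)$ chips on every subtree (connected subgraph) of $T$ with $m$ vertices.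
   Formalization: The convex combinations of points of $S_\ell^{(T)}$ that place x in $tP_\ell(T)$ have rational weights. -}

module Defs where

open import Data.Nat as ℕ using (ℕ; zero; suc)
open import Data.Integer as ℤ using (ℤ; +_)
open import Data.Rational as ℚ using (ℚ; 0ℚ; 1ℚ)
open import Data.Fin using (Fin; zero; suc)
open import Data.Bool using (Bool; true; false; if_then_else_)
open import Data.List using (List; []; _∷_)
open import Data.List.Relation.Unary.All using (All)
open import Data.Product using (Σ; _×_; _,_; ∃)
open import Relation.Binary.PropositionalEquality using (_≡_)
import Data.Fin
import Relation.Nullary

Σℕ : ∀ {n} → (Fin n → ℕ) → ℕ
Σℕ {zero}  f = 0
Σℕ {suc n} f = f zero ℕ.+ Σℕ (λ i → f (suc i))

Σℤ : ∀ {n} → (Fin n → ℤ) → ℤ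
Σℤ {zero}  f = + 0
Σℤ {suc n} f = f zero ℤ.+ Σℤ (λ i → f (suc i))

Σℚ : ∀ {n} → (Fin n → ℚ) → ℚ
Σℚ {zero}  f = 0ℚ
Σℚ {suc n} f = f zero ℚ.+ Σℚ (λ i → f (suc i))

record Graph (n : ℕ) : Set where
  field
    adj    : Fin n → Fin n → Bool
    sym    : ∀ i j → adj i j ≡ adj j i
    irrefl : ∀ i → adj i i ≡ false
open Graph public

deg : ∀ {n} → Graph n → Fin n → ℕ
deg G i = Σℕ (λ j → if adj G i j then 1 else 0)

data Walk {n} (G : Graph n) (S : Fin n → Bool) : Fin n → Fin n → Set where
  here : ∀ {u} → S u ≡ true → Walk G S u u
  step : ∀ {u v w} → S u ≡ true → adj G u v ≡ true → Walk G S v w → Walk G S u w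

ConnectedOn : ∀ {n} → Graph n → (Fin n → Bool) → Set
ConnectedOn G S = ∀ u v → S u ≡ true → S v ≡ true → Walk G S u v

-- A tree: connected graph with exactly n - 1 edges (sum of degrees = 2(n-1))
IsTree : ∀ {n} → Graph n → Set
IsTree {n} G = ConnectedOn G (λ _ → true) × Σℕ (deg G) ≡ 2 ℕ.* (n ℕ.∸ 1)

-- Subtree = nonempty connected subgraph, recorded by its vertex set
IsSubtree : ∀ {n} → Graph n → (Fin n → Bool) → Set
IsSubtree G S = (∃ λ u → S u ≡ true) × ConnectedOn G S

size : ∀ {n} → (Fin n → Bool) → ℕ
size S = Σℕ (λ i → if S i then 1 else 0)

Config : ℕ → Set
Config n = Fin n → ℕ

total : ∀ {n} → Config n → ℕ
total c = Σℕ c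

fire : ∀ {n} → Graph n → Config n → Fin n → Config n
fire G c i j with i Data.Fin.≟ j
... | Relation.Nullary.yes _ = c j ℕ.∸ deg G i
... | Relation.Nullary.no  _ = if adj G i j then suc (c j) else c j

Legal : ∀ {n} → Graph n → Config n → Fin n → Set
Legal G c i = deg G i ℕ.≤ c i

data Reach⁺ {n} (G : Graph n) (c : Config n) : Config n → Set where
  one  : ∀ i → Legal G c i → Reach⁺ G c (fire G c i)
  more : ∀ {d} i → Reach⁺ G c d → Legal G d i → Reach⁺ G c (fire G d i)

SelfReachable : ∀ {n} → Graph n → Config n → Set
SelfReachable G c = Σ (Config _) λ d → Reach⁺ G c d × (∀ j → d j ≡ c j)

InS : ∀ {n} → Graph n → ℕ → Config n → Set
InS G ℓ c = SelfReachable G c × total c ≡ ℓ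

ℕ→ℚ : ℕ → ℚ
ℕ→ℚ k = + k ℚ./ 1

ℤ→ℚ : ℤ → ℚ
ℤ→ℚ z = z ℚ./ 1

combo : ∀ {n} → List (ℚ × Config n) → Fin n → ℚ
combo []              j = 0ℚ
combo ((λ₁ , c) ∷ xs) j = λ₁ ℚ.* ℕ→ℚ (c j) ℚ.+ combo xs j

weights : ∀ {n} → List (ℚ × Config n) → ℚ
weights []              = 0ℚ
weights ((λ₁ , c) ∷ xs) = λ₁ ℚ.+ weights xs

-- x ∈ t · conv(S_ℓ(T)) for x ∈ ℤⁿ (convex combinations with rational weights)
InDilatedP : ∀ {n} → Graph n → ℕ → ℕ → (Fin n → ℤ) → Set
InDilatedP {n} G ℓ t x =
  Σ (List (ℚ × Config n)) λ L →
      All (λ p → (0ℚ ℚ.≤ Data.Product.proj₁ p) × InS G ℓ (Data.Product.proj₂ p)) L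
    × weights L ≡ 1ℚ
    × (∀ j → ℤ→ℚ (x j) ≡ ℕ→ℚ t ℚ.* combo L j)

chipsOn : ∀ {n} → (Fin n → Bool) → (Fin n → ℤ) → ℤ
chipsOn S x = Σℤ (λ i → if S i then x i else + 0)

TDilated : ∀ {n} → Graph n → ℕ → (Fin n → ℤ) → Set
TDilated G t x =
    (∀ i → + 0 ℤ.≤ x i)
  × (∀ S → IsSubtree G S → + t ℤ.* (+ size S ℤ.- + 1) ℤ.≤ chipsOn S x)

-- Follow a firing sequence that returns c to itself and record when each vertex fires for the last
-- time. A neighbour firing after v's last firing leaves a chip on v for good, so c v is at least the
-- number of such neighbours; and every vertex fires, since an unfired vertex next to a fired one would
-- end with more chips than it started with. Orienting each edge towards its later-firing endpoint, the
-- chips of c on a subtree with m vertices thus bound its number of edges, which is at least m − 1 as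
-- the subtree is connected. This bound is linear in c, so it survives convex combinations and scales by t.

module Submission where

open import Defs
open import Data.Nat using (ℕ; _≤_)
open import Data.Integer using (ℤ)
open import Data.Fin using (Fin)

open import Algebra.Bundles using (CommutativeMonoid)
import Algebra.Properties.CommutativeSemigroup as CommSemigroupProperties
open import Data.Bool as Bool using (Bool; true; false; if_then_else_; _∧_)
open import Data.Bool.Properties using (if-float; if-eta; if-cong-then; if-cong-else; ¬-not; not-¬)
open import Data.Empty using (⊥-elim)
open import Data.Fin using (zero; suc; _≟_)
open import Data.Fin.Properties using (any?; suc-injective)
open import Data.Integer as ℤ using (+_)
import Data.Integer.Properties as ℤₚ
open import Data.List using (List; []; _∷_)
open import Data.List.Relation.Unary.All as All using (All; []; _∷_)
open import Data.Nat using (zero; suc; _+_; _∸_; _<_; _<?_; _≤?_; z≤n; s≤s)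
open import Data.Nat.Properties
  using (≤-refl; ≤-reflexive; ≤-trans; +-mono-≤; +-mono-≤-<; +-monoʳ-≤; m≤m+n; m≤n+m; +-assoc; +-suc;
         +-identityʳ; <-cmp; <⇒≱; 1+n≰n; m+1+n≰m; m≤n⇒m≤1+n; 0≢1+n; n<1⇒n≡0; ≰⇒>; ∸-monoˡ-≤;
         +-commutativeSemigroup; module ≤-Reasoning)
open import Data.Product using (Σ; ∃; ∃₂; _×_; _,_; proj₁; proj₂)
open import Data.Rational as ℚ using (ℚ; 0ℚ; 1ℚ; *≤*)
import Data.Rational.Properties as ℚₚ
open import Data.Rational.Literals using (fromℤ)
open import Data.Sum using (_⊎_; inj₁; inj₂)
open import Data.Vec.Functional using (updateAt)
open import Data.Vec.Functional.Properties using (updateAt-updates; updateAt-minimal)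
open import Function using (_∘_; const; case_of_)
open import Function.Definitions using (Injective)
open import Relation.Binary using (tri<; tri≈; tri>)
open import Relation.Binary.PropositionalEquality as ≡
  using (_≡_; _≢_; refl; cong; cong₂; subst; subst₂; module ≡-Reasoning)
open import Relation.Nullary using (¬_; yes; no; does)
open import Relation.Nullary.Decidable using (dec-true; dec-false; _×-dec_)
open import Relation.Unary using (Decidable)

module ℕ+ = CommSemigroupProperties +-commutativeSemigroup
module ℚ+ = CommSemigroupProperties (CommutativeMonoid.commutativeSemigroup ℚₚ.+-0-commutativeMonoid)

ind : Bool → ℕ
ind b = if b then 1 else 0

ind-mono : ∀ {a b} → (a ≡ true → b ≡ true) → ind a ≤ ind b
ind-mono {false} _ = z≤n
ind-mono {true} a⇒b rewrite a⇒b refl = ≤-refl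

ind-∧-≤ˡ : ∀ a b → ind (a ∧ b) ≤ ind a
ind-∧-≤ˡ false b     = z≤n
ind-∧-≤ˡ true  false = z≤n
ind-∧-≤ˡ true  true  = ≤-refl

ind-∧-≤ʳ : ∀ a b → ind (a ∧ b) ≤ ind b
ind-∧-≤ʳ false b = z≤n
ind-∧-≤ʳ true  b = ≤-refl

ind-∧-false : ∀ a {b} → b ≡ false → ind (a ∧ b) ≡ 0
ind-∧-false false refl = refl
ind-∧-false true  refl = refl

Σℕ-cong : ∀ {n} {f g : Fin n → ℕ} → (∀ i → f i ≡ g i) → Σℕ f ≡ Σℕ g
Σℕ-cong {zero}  f≗g = refl
Σℕ-cong {suc n} f≗g = cong₂ _+_ (f≗g zero) (Σℕ-cong (f≗g ∘ suc))

Σℕ-zeros : ∀ {n} {f : Fin n → ℕ} → (∀ i → f i ≡ 0) → Σℕ f ≡ 0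
Σℕ-zeros {zero}  f≗0 = refl
Σℕ-zeros {suc n} f≗0 = cong₂ _+_ (f≗0 zero) (Σℕ-zeros (f≗0 ∘ suc))

Σℕ-mono-≤ : ∀ {n} {f g : Fin n → ℕ} → (∀ i → f i ≤ g i) → Σℕ f ≤ Σℕ g
Σℕ-mono-≤ {zero}  f≤g = z≤n
Σℕ-mono-≤ {suc n} f≤g = +-mono-≤ (f≤g zero) (Σℕ-mono-≤ (f≤g ∘ suc))

Σℕ-mono-<-at : ∀ {n} {f g : Fin n → ℕ} p → (∀ i → f i ≤ g i) → f p < g p → Σℕ f < Σℕ g
Σℕ-mono-<-at zero    f≤g fp<gp = +-mono-≤ fp<gp (Σℕ-mono-≤ (f≤g ∘ suc))
Σℕ-mono-<-at (suc p) f≤g fp<gp = +-mono-≤-< (f≤g zero) (Σℕ-mono-<-at p (f≤g ∘ suc) fp<gp)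

Σℕ-mono-≤-except : ∀ {n} {f g : Fin n → ℕ} p e → (∀ i → i ≢ p → f i ≤ g i) → f p ≤ e + g p → Σℕ f ≤ e + Σℕ g
Σℕ-mono-≤-except {f = f} {g} zero e f≤g fp≤ = begin
  f zero + Σℕ (f ∘ suc)      ≤⟨ +-mono-≤ fp≤ (Σℕ-mono-≤ λ i → f≤g (suc i) λ ()) ⟩
  e + g zero + Σℕ (g ∘ suc)  ≡⟨ +-assoc e (g zero) _ ⟩
  e + Σℕ g                   ∎
  where open ≤-Reasoning
Σℕ-mono-≤-except {f = f} {g} (suc p) e f≤g fp≤ = begin
  f zero + Σℕ (f ∘ suc)       ≤⟨ +-mono-≤ (f≤g zero λ ()) (Σℕ-mono-≤-except p e (λ i i≢p → f≤g (suc i) (i≢p ∘ suc-injective)) fp≤) ⟩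
  g zero + (e + Σℕ (g ∘ suc)) ≡⟨ ℕ+.x∙yz≈y∙xz (g zero) e _ ⟩
  e + Σℕ g                    ∎
  where open ≤-Reasoning

Σℕ-term-≤ : ∀ {n} (f : Fin n → ℕ) i → f i ≤ Σℕ f
Σℕ-term-≤ f zero    = m≤m+n (f zero) _
Σℕ-term-≤ f (suc i) = ≤-trans (Σℕ-term-≤ (f ∘ suc) i) (m≤n+m _ (f zero))

walk-crosses : ∀ {n} {G : Graph n} {S} {P : Fin n → Set} → Decidable P → ∀ {u r} → Walk G S u r → ¬ P u → P r →
               ∃₂ λ a b → S a ≡ true × ¬ P a × P b × adj G a b ≡ true
walk-crosses P? (here _) ¬Pu Pr = ⊥-elim (¬Pu Pr)
walk-crosses P? {u} (step {v = v} Su uv walk) ¬Pu Pr with P? v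
... | yes Pv  = u , v , Su , ¬Pu , Pv , uv
... | no ¬Pv = walk-crosses P? walk ¬Pv Pr

-- Firing histories

before : ∀ {n} → (Fin n → ℕ) → Fin n → Fin n → Bool
before σ v w = does (σ v <? σ w)

outdeg : ∀ {n} → Graph n → (Fin n → Fin n → Bool) → Fin n → ℕ
outdeg G _≺_ v = Σℕ λ w → ind (adj G v w ∧ v ≺ w)

-- lastFiring v = 0 means that v has not fired yet; firings are numbered from 1.
record FiringHistory {n} (G : Graph n) (c d : Config n) : Set where
  field
    lastFiring           : Fin n → ℕ
    clock                : ℕ
    lastFiring≤clock     : ∀ v → lastFiring v ≤ clock
    lastFiring-injective : ∀ v w → 1 ≤ lastFiring v → lastFiring v ≡ lastFiring w → v ≡ w
    fired-bound          : ∀ v → 1 ≤ lastFiring v → outdeg G (before lastFiring) v ≤ d v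
    unfired-bound        : ∀ v → lastFiring v ≡ 0 → c v + outdeg G (before lastFiring) v ≤ d v

noFirings : ∀ {n} (G : Graph n) (c : Config n) → FiringHistory G c c
noFirings G c = record
  { lastFiring           = const 0
  ; clock                = 0
  ; lastFiring≤clock     = λ _ → z≤n
  ; lastFiring-injective = λ _ _ ()
  ; fired-bound          = λ _ ()
  ; unfired-bound        = λ v _ → ≤-reflexive (≡.trans (cong (λ k → c v + k) (Σℕ-zeros λ w → ind-∧-false (adj G v w) refl))
                                                         (+-identityʳ (c v)))
  }

fire-other : ∀ {n} (G : Graph n) (d : Config n) {i v} → i ≢ v → fire G d i v ≡ ind (adj G v i) + d v
fire-other G d {i} {v} i≢v with i ≟ v
... | yes i≡v = ⊥-elim (i≢v i≡v)
... | no _ rewrite sym G v i with adj G i v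
...   | true  = refl
...   | false = refl

module AfterFiring {n} {G : Graph n} {c d : Config n} (H : FiringHistory G c d) (i : Fin n) where
  open FiringHistory H renaming (lastFiring to σ)

  σ′ : Fin n → ℕ
  σ′ = updateAt σ i (const (suc clock))

  σ′-fired : σ′ i ≡ suc clock
  σ′-fired = updateAt-updates i σ

  σ′-other : ∀ {v} → i ≢ v → σ′ v ≡ σ v
  σ′-other i≢v = updateAt-minimal _ i σ (i≢v ∘ ≡.sym)

  σ′≤clock+1 : ∀ v → σ′ v ≤ suc clock
  σ′≤clock+1 v with i ≟ v
  ... | yes refl = ≤-reflexive σ′-fired
  ... | no i≢v   = ≤-trans (≤-reflexive (σ′-other i≢v)) (m≤n⇒m≤1+n (lastFiring≤clock v))

  σ≢clock+1 : ∀ v → σ v ≢ suc clock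
  σ≢clock+1 v σv≡ = 1+n≰n (subst (_≤ clock) σv≡ (lastFiring≤clock v))

  outdeg-fired : outdeg G (before σ′) i ≡ 0
  outdeg-fired = Σℕ-zeros λ w → ind-∧-false (adj G i w) (dec-false (σ′ i <? σ′ w) λ i<w →
                   <⇒≱ i<w (subst (σ′ w ≤_) (≡.sym σ′-fired) (σ′≤clock+1 w)))

  outdeg-other : ∀ {v} → i ≢ v → outdeg G (before σ′) v ≤ ind (adj G v i) + outdeg G (before σ) v
  outdeg-other {v} i≢v = Σℕ-mono-≤-except i (ind (adj G v i)) unchanged (≤-trans (ind-∧-≤ˡ (adj G v i) _) (m≤m+n _ _))
    where
    unchanged : ∀ w → w ≢ i → ind (adj G v w ∧ before σ′ v w) ≤ ind (adj G v w ∧ before σ v w)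
    unchanged w w≢i = ≤-reflexive (cong₂ (λ a b → ind (adj G v w ∧ does (a <? b))) (σ′-other i≢v) (σ′-other (w≢i ∘ ≡.sym)))

  injective : ∀ v w → 1 ≤ σ′ v → σ′ v ≡ σ′ w → v ≡ w
  injective v w σ′v≥1 σ′v≡σ′w with i ≟ v | i ≟ w
  ... | yes refl | yes refl = refl
  ... | yes refl | no i≢w   = ⊥-elim (σ≢clock+1 w (≡.trans (≡.sym (σ′-other i≢w)) (≡.trans (≡.sym σ′v≡σ′w) σ′-fired)))
  ... | no i≢v   | yes refl = ⊥-elim (σ≢clock+1 v (≡.trans (≡.sym (σ′-other i≢v)) (≡.trans σ′v≡σ′w σ′-fired)))
  ... | no i≢v   | no i≢w   = lastFiring-injective v w (subst (1 ≤_) (σ′-other i≢v) σ′v≥1)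
                                (≡.trans (≡.sym (σ′-other i≢v)) (≡.trans σ′v≡σ′w (σ′-other i≢w)))

  fired-bound-other : ∀ {v} → i ≢ v → 1 ≤ σ′ v → outdeg G (before σ′) v ≤ fire G d i v
  fired-bound-other {v} i≢v σ′v≥1 = begin
    outdeg G (before σ′) v                  ≤⟨ outdeg-other i≢v ⟩
    ind (adj G v i) + outdeg G (before σ) v ≤⟨ +-monoʳ-≤ _ (fired-bound v (subst (1 ≤_) (σ′-other i≢v) σ′v≥1)) ⟩
    ind (adj G v i) + d v                   ≡⟨ ≡.sym (fire-other G d i≢v) ⟩
    fire G d i v                            ∎
    where open ≤-Reasoning

  unfired-bound-other : ∀ {v} → i ≢ v → σ′ v ≡ 0 → c v + outdeg G (before σ′) v ≤ fire G d i v
  unfired-bound-other {v} i≢v σ′v≡0 = begin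
    c v + outdeg G (before σ′) v                    ≤⟨ +-monoʳ-≤ (c v) (outdeg-other i≢v) ⟩
    c v + (ind (adj G v i) + outdeg G (before σ) v) ≡⟨ ℕ+.x∙yz≈y∙xz (c v) (ind (adj G v i)) _ ⟩
    ind (adj G v i) + (c v + outdeg G (before σ) v) ≤⟨ +-monoʳ-≤ _ (unfired-bound v (≡.trans (≡.sym (σ′-other i≢v)) σ′v≡0)) ⟩
    ind (adj G v i) + d v                           ≡⟨ ≡.sym (fire-other G d i≢v) ⟩
    fire G d i v                                    ∎
    where open ≤-Reasoning

  fired-bound′ : ∀ v → 1 ≤ σ′ v → outdeg G (before σ′) v ≤ fire G d i v
  fired-bound′ v σ′v≥1 = case i ≟ v of λ where
    (yes refl) → ≤-trans (≤-reflexive outdeg-fired) z≤n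
    (no i≢v)   → fired-bound-other i≢v σ′v≥1

  unfired-bound′ : ∀ v → σ′ v ≡ 0 → c v + outdeg G (before σ′) v ≤ fire G d i v
  unfired-bound′ v σ′v≡0 = case i ≟ v of λ where
    (yes refl) → ⊥-elim (0≢1+n (≡.trans (≡.sym σ′v≡0) σ′-fired))
    (no i≢v)   → unfired-bound-other i≢v σ′v≡0

  history : FiringHistory G c (fire G d i)
  history = record
    { lastFiring           = σ′
    ; clock                = suc clock
    ; lastFiring≤clock     = σ′≤clock+1
    ; lastFiring-injective = injective
    ; fired-bound          = fired-bound′
    ; unfired-bound        = unfired-bound′
    }

  fires : 1 ≤ σ′ i
  fires = subst (1 ≤_) (≡.sym σ′-fired) (s≤s z≤n)

firingHistory : ∀ {n} {G : Graph n} {c d : Config n} → Reach⁺ G c d →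
                Σ (FiringHistory G c d) λ H → ∃ λ v → 1 ≤ FiringHistory.lastFiring H v
firingHistory {G = G} {c} (one i _) = AfterFiring.history (noFirings G c) i , i , AfterFiring.fires (noFirings G c) i
firingHistory (more i reach _) = let H = proj₁ (firingHistory reach) in AfterFiring.history H i , i , AfterFiring.fires H i

module _ {n} {G : Graph n} {c d : Config n} (H : FiringHistory G c d) where
  open FiringHistory H renaming (lastFiring to σ)

  everyVertexFires : ConnectedOn G (const true) → (∀ v → d v ≡ c v) → (∃ λ r → 1 ≤ σ r) → ∀ v → 1 ≤ σ v
  everyVertexFires connected d≗c (r , r-fired) v with 1 ≤? σ v
  ... | yes v-fired = v-fired
  ... | no v-unfired with walk-crosses (λ x → 1 ≤? σ x) (connected v r refl refl) v-unfired r-fired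
  ...   | a , b , _ , a-unfired , b-fired , ab = ⊥-elim (m+1+n≰m (c a) (begin
    c a + 1                     ≤⟨ +-monoʳ-≤ (c a) (≤-trans (≤-reflexive (≡.sym b-later)) (Σℕ-term-≤ _ b)) ⟩
    c a + outdeg G (before σ) a ≤⟨ unfired-bound a σa≡0 ⟩
    d a                         ≡⟨ d≗c a ⟩
    c a                         ∎))
    where
    open ≤-Reasoning
    σa≡0 : σ a ≡ 0
    σa≡0 = n<1⇒n≡0 (≰⇒> a-unfired)
    b-later : ind (adj G a b ∧ before σ a b) ≡ 1
    b-later rewrite ab | dec-true (σ a <? σ b) (subst (_< σ b) (≡.sym σa≡0) b-fired) = refl

selfReachable-ordering : ∀ {n} {G : Graph n} {c : Config n} → ConnectedOn G (const true) → SelfReachable G c →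
                         ∃ λ σ → Injective _≡_ _≡_ σ × (∀ v → outdeg G (before σ) v ≤ c v)
selfReachable-ordering {G = G} connected (d , reach , d≗c) with firingHistory reach
... | H , some-fired = σ , (λ {v} {w} → lastFiring-injective v w (fired v)) ,
                         (λ v → subst (outdeg G (before σ) v ≤_) (d≗c v) (fired-bound v (fired v)))
  where
  open FiringHistory H renaming (lastFiring to σ)
  fired : ∀ v → 1 ≤ σ v
  fired = everyVertexFires H connected d≗c some-fired

before-connex : ∀ {n} {σ : Fin n → ℕ} → Injective _≡_ _≡_ σ → ∀ v w → v ≢ w → before σ v w ≡ true ⊎ before σ w v ≡ true
before-connex {σ = σ} σ-injective v w v≢w with <-cmp (σ v) (σ w)
... | tri< v<w _ _ = inj₁ (dec-true (σ v <? σ w) v<w)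
... | tri≈ _ σv≡σw _ = ⊥-elim (v≢w (σ-injective σv≡σw))
... | tri> _ _ w<v = inj₂ (dec-true (σ w <? σ v) w<v)

-- Edges spanned by connected vertex sets

_⊆_ : ∀ {n} → (Fin n → Bool) → (Fin n → Bool) → Set
A ⊆ B = ∀ v → A v ≡ true → B v ≡ true

⊆-antisym : ∀ {n} {A B : Fin n → Bool} → A ⊆ B → B ⊆ A → ∀ v → A v ≡ B v
⊆-antisym {A = A} {B} A⊆B B⊆A v with A v in Av | B v in Bv
... | true  | true  = refl
... | false | false = refl
... | true  | false = ≡.trans (≡.sym (A⊆B v Av)) Bv
... | false | true  = ≡.trans (≡.sym Av) (B⊆A v Bv)

insert : ∀ {n} → Fin n → (Fin n → Bool) → Fin n → Bool
insert a A = updateAt A a (const true)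

insert-self : ∀ {n} a (A : Fin n → Bool) → insert a A a ≡ true
insert-self a A = updateAt-updates a A

insert-other : ∀ {n} {a v} (A : Fin n → Bool) → v ≢ a → insert a A v ≡ A v
insert-other A v≢a = updateAt-minimal _ _ A v≢a

⊆-insert : ∀ {n} a (A : Fin n → Bool) → A ⊆ insert a A
⊆-insert a A v Av with v ≟ a
... | yes refl = insert-self a A
... | no v≢a   = ≡.trans (insert-other A v≢a) Av

insert-⊆ : ∀ {n} {a} {A S : Fin n → Bool} → A ⊆ S → S a ≡ true → insert a A ⊆ S
insert-⊆ {a = a} {A} A⊆S Sa v A′v with v ≟ a
... | yes refl = Sa
... | no v≢a   = A⊆S v (≡.trans (≡.sym (insert-other A v≢a)) A′v)

separated-by : ∀ {n} (A : Fin n → Bool) {a b} → A a ≡ false → A b ≡ true → a ≢ b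
separated-by A Aa Ab refl with ≡.trans (≡.sym Aa) Ab
... | ()

size-mono : ∀ {n} {A B : Fin n → Bool} → A ⊆ B → size A ≤ size B
size-mono A⊆B = Σℕ-mono-≤ λ v → ind-mono (A⊆B v)

size-insert-≤ : ∀ {n} a (A : Fin n → Bool) → size (insert a A) ≤ suc (size A)
size-insert-≤ a A = Σℕ-mono-≤-except a 1 (λ v v≢a → ≤-reflexive (cong ind (insert-other A v≢a)))
                      (≤-trans (ind-mono {b = true} (const refl)) (m≤m+n 1 _))

size-insert-> : ∀ {n} a (A : Fin n → Bool) → A a ≡ false → size A < size (insert a A)
size-insert-> a A Aa≡false = Σℕ-mono-<-at a (λ v → ind-mono (⊆-insert a A v))
                                (subst₂ (λ x y → ind x < ind y) (≡.sym Aa≡false) (≡.sym (insert-self a A)) ≤-refl)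

chipsOnℕ : ∀ {n} → (Fin n → Bool) → Config n → ℕ
chipsOnℕ S c = Σℕ λ v → if S v then c v else 0

ind-∧∧-mono : ∀ {x y x′ y′} z → (x ≡ true → x′ ≡ true) → (y ≡ true → y′ ≡ true) → ind (x ∧ y ∧ z) ≤ ind (x′ ∧ y′ ∧ z)
ind-∧∧-mono {false}        z _  _  = z≤n
ind-∧∧-mono {true} {false} z _  _  = z≤n
ind-∧∧-mono {true} {true}  z x⇒ y⇒ rewrite x⇒ refl | y⇒ refl = ≤-refl

ind-∧∧-< : ∀ {x y x′ y′ z} → x ≡ false ⊎ y ≡ false → x′ ≡ true → y′ ≡ true → z ≡ true → ind (x ∧ y ∧ z) < ind (x′ ∧ y′ ∧ z)
ind-∧∧-<             (inj₁ refl) refl refl refl = s≤s z≤n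
ind-∧∧-< {x = false} (inj₂ refl) refl refl refl = s≤s z≤n
ind-∧∧-< {x = true}  (inj₂ refl) refl refl refl = s≤s z≤n

module _ {n} (G : Graph n) (_≺_ : Fin n → Fin n → Bool) where

  edgesIn : (Fin n → Bool) → ℕ
  edgesIn A = Σℕ λ v → Σℕ λ w → ind (A v ∧ A w ∧ adj G v w ∧ v ≺ w)

  edgesIn-cong : ∀ {A B} → (∀ v → A v ≡ B v) → edgesIn A ≡ edgesIn B
  edgesIn-cong A≗B = Σℕ-cong λ v → Σℕ-cong λ w → cong₂ (λ x y → ind (x ∧ y ∧ adj G v w ∧ v ≺ w)) (A≗B v) (A≗B w)

  edgesIn-<-at : ∀ {A B} → A ⊆ B → ∀ p q → A p ≡ false ⊎ A q ≡ false → B p ≡ true → B q ≡ true →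
                 adj G p q ∧ p ≺ q ≡ true → edgesIn A < edgesIn B
  edgesIn-<-at {A} {B} A⊆B p q new Bp Bq pq =
    Σℕ-mono-<-at p (λ v → Σℕ-mono-≤ (kept v)) (Σℕ-mono-<-at q (kept p) (ind-∧∧-< new Bp Bq pq))
    where
    kept : ∀ v w → ind (A v ∧ A w ∧ adj G v w ∧ v ≺ w) ≤ ind (B v ∧ B w ∧ adj G v w ∧ v ≺ w)
    kept v w = ind-∧∧-mono (adj G v w ∧ v ≺ w) (A⊆B v) (A⊆B w)

  module _ (≺-connex : ∀ v w → v ≢ w → v ≺ w ≡ true ⊎ w ≺ v ≡ true) where

    edgesIn-insert : ∀ {a b A} → A a ≡ false → A b ≡ true → adj G a b ≡ true → edgesIn A < edgesIn (insert a A)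
    edgesIn-insert {a} {b} {A} Aa Ab ab with ≺-connex a b (separated-by A Aa Ab)
    ... | inj₁ a≺b = edgesIn-<-at (⊆-insert a A) a b (inj₁ Aa) (insert-self a A) (⊆-insert a A b Ab)
                       (cong₂ _∧_ ab a≺b)
    ... | inj₂ b≺a = edgesIn-<-at (⊆-insert a A) b a (inj₂ Aa) (⊆-insert a A b Ab) (insert-self a A)
                       (cong₂ _∧_ (≡.trans (sym G b a) ab) b≺a)

    size≤1+edgesIn-insert : ∀ {a b A} → A a ≡ false → A b ≡ true → adj G a b ≡ true →
                            size A ≤ suc (edgesIn A) → size (insert a A) ≤ suc (edgesIn (insert a A))
    size≤1+edgesIn-insert {a} {A = A} Aa Ab ab A-ok =
      ≤-trans (size-insert-≤ a A) (s≤s (≤-trans A-ok (edgesIn-insert Aa Ab ab)))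

    connected⇒size≤1+edgesIn : ∀ {S r} → ConnectedOn G S → S r ≡ true → size S ≤ suc (edgesIn S)
    connected⇒size≤1+edgesIn {S} {r} connected Sr =
      grow (size S) (insert r (const false)) (insert-⊆ (λ _ ()) Sr) (insert-self r (const false)) (m≤m+n _ _)
           (≤-trans (size-insert-≤ r (const false)) (s≤s (≤-trans (≤-reflexive (Σℕ-zeros {n} λ _ → refl)) z≤n)))
      where
      grow : ∀ k A → A ⊆ S → A r ≡ true → size S ≤ k + size A → size A ≤ suc (edgesIn A) → size S ≤ suc (edgesIn S)
      grow k A A⊆S Ar fuel A-ok with any? (λ v → (S v Bool.≟ true) ×-dec (A v Bool.≟ false))
      ... | no S⊈A = subst₂ (λ s e → s ≤ suc e) (Σℕ-cong (cong ind ∘ A≗S)) (edgesIn-cong A≗S) A-ok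
        where
        A≗S : ∀ v → A v ≡ S v
        A≗S = ⊆-antisym A⊆S (λ v Sv → ¬-not (λ Av → S⊈A (v , Sv , Av)))
      ... | yes (v , Sv , Av) with walk-crosses (λ x → A x Bool.≟ true) (connected v r Sv Sr) (not-¬ Av) Ar
      ...   | a , b , Sa , ¬Aa , Ab , ab = continue k fuel
        where
        Aa : A a ≡ false
        Aa = ¬-not ¬Aa
        continue : ∀ k → size S ≤ k + size A → size S ≤ suc (edgesIn S)
        continue zero    fuel = ⊥-elim (<⇒≱ (≤-trans (size-insert-> a A Aa) (size-mono (insert-⊆ A⊆S Sa))) fuel)
        continue (suc k) fuel = grow k (insert a A) (insert-⊆ A⊆S Sa) (⊆-insert a A r Ar)
          (≤-trans fuel (≤-trans (≤-reflexive (≡.sym (+-suc k _))) (+-monoʳ-≤ k (size-insert-> a A Aa))))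
          (size≤1+edgesIn-insert Aa Ab ab A-ok)

  edgesIn-≤-chipsOn : ∀ {c : Config n} → (∀ v → outdeg G _≺_ v ≤ c v) → ∀ S → edgesIn S ≤ chipsOnℕ S c
  edgesIn-≤-chipsOn {c} outdeg≤c S = Σℕ-mono-≤ row
    where
    row : ∀ v → Σℕ (λ w → ind (S v ∧ S w ∧ adj G v w ∧ v ≺ w)) ≤ (if S v then c v else 0)
    row v with S v
    ... | true  = ≤-trans (Σℕ-mono-≤ λ w → ind-∧-≤ʳ (S w) _) (outdeg≤c v)
    ... | false = ≤-reflexive (Σℕ-zeros {n} λ _ → refl)

selfReachable⇒subtree-chips : ∀ {n} {G : Graph n} {c : Config n} {S} → ConnectedOn G (const true) →
                              SelfReachable G c → IsSubtree G S → size S ≤ suc (chipsOnℕ S c)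
selfReachable⇒subtree-chips {G = G} {S = S} connected selfReachable ((r , Sr) , S-connected)
  with selfReachable-ordering connected selfReachable
... | σ , σ-injective , outdeg≤c =
  ≤-trans (connected⇒size≤1+edgesIn G (before σ) (before-connex σ-injective) S-connected Sr)
          (s≤s (edgesIn-≤-chipsOn G (before σ) outdeg≤c S))

size-positive : ∀ {n} {G : Graph n} {S} → IsSubtree G S → 1 ≤ size S
size-positive {S = S} ((r , Sr) , _) = subst (λ b → ind b ≤ size S) Sr (Σℕ-term-≤ (ind ∘ S) r)

-- Convex combinations over ℚ

-- ℤ→ℚ normalises through _/_, whereas the literal fromℤ z is already normal, so ℚ's operations compute on it.
ℤ→ℚ≡fromℤ : ∀ z → ℤ→ℚ z ≡ fromℤ z
ℤ→ℚ≡fromℤ z = ℚₚ.↥p/↧p≡p (fromℤ z)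

ℤ→ℚ-+ : ∀ a b → ℤ→ℚ (a ℤ.+ b) ≡ ℤ→ℚ a ℚ.+ ℤ→ℚ b
ℤ→ℚ-+ a b = ≡.trans (cong (ℚ._/ 1) (cong₂ ℤ._+_ (≡.sym (ℤₚ.*-identityʳ a)) (≡.sym (ℤₚ.*-identityʳ b))))
                    (≡.sym (cong₂ ℚ._+_ (ℤ→ℚ≡fromℤ a) (ℤ→ℚ≡fromℤ b)))

ℤ→ℚ-* : ∀ a b → ℤ→ℚ (a ℤ.* b) ≡ ℤ→ℚ a ℚ.* ℤ→ℚ b
ℤ→ℚ-* a b = ≡.sym (cong₂ ℚ._*_ (ℤ→ℚ≡fromℤ a) (ℤ→ℚ≡fromℤ b))

ℤ→ℚ-mono-≤ : ∀ {a b} → a ℤ.≤ b → ℤ→ℚ a ℚ.≤ ℤ→ℚ b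
ℤ→ℚ-mono-≤ {a} {b} a≤b = subst₂ ℚ._≤_ (≡.sym (ℤ→ℚ≡fromℤ a)) (≡.sym (ℤ→ℚ≡fromℤ b))
  (*≤* (subst₂ ℤ._≤_ (≡.sym (ℤₚ.*-identityʳ a)) (≡.sym (ℤₚ.*-identityʳ b)) a≤b))

ℤ→ℚ-cancel-≤ : ∀ {a b} → ℤ→ℚ a ℚ.≤ ℤ→ℚ b → a ℤ.≤ b
ℤ→ℚ-cancel-≤ {a} {b} a≤b = subst₂ ℤ._≤_ (ℤₚ.*-identityʳ a) (ℤₚ.*-identityʳ b)
  (ℚₚ.drop-*≤* (subst₂ ℚ._≤_ (ℤ→ℚ≡fromℤ a) (ℤ→ℚ≡fromℤ b) a≤b))

ℕ→ℚ-mono-≤ : ∀ {m n} → m ≤ n → ℕ→ℚ m ℚ.≤ ℕ→ℚ n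
ℕ→ℚ-mono-≤ m≤n = ℤ→ℚ-mono-≤ (ℤ.+≤+ m≤n)

0≤ℕ→ℚ : ∀ k → 0ℚ ℚ.≤ ℕ→ℚ k
0≤ℕ→ℚ k = ℕ→ℚ-mono-≤ {0} {k} z≤n

*-monoˡ-≤-ℕ→ℚ : ∀ k {p q} → p ℚ.≤ q → ℕ→ℚ k ℚ.* p ℚ.≤ ℕ→ℚ k ℚ.* q
*-monoˡ-≤-ℕ→ℚ k = ℚₚ.*-monoˡ-≤-nonNeg (ℕ→ℚ k) {{ℚ.nonNegative (0≤ℕ→ℚ k)}}

Σℚ-cong : ∀ {n} {f g : Fin n → ℚ} → (∀ i → f i ≡ g i) → Σℚ f ≡ Σℚ g
Σℚ-cong {zero}  f≗g = refl
Σℚ-cong {suc n} f≗g = cong₂ ℚ._+_ (f≗g zero) (Σℚ-cong (f≗g ∘ suc))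

Σℚ-zeros : ∀ {n} {f : Fin n → ℚ} → (∀ i → f i ≡ 0ℚ) → Σℚ f ≡ 0ℚ
Σℚ-zeros {zero}  f≗0 = refl
Σℚ-zeros {suc n} f≗0 = ≡.trans (cong₂ ℚ._+_ (f≗0 zero) (Σℚ-zeros (f≗0 ∘ suc))) (ℚₚ.+-identityʳ 0ℚ)

Σℚ-+ : ∀ {n} (f g : Fin n → ℚ) → Σℚ (λ i → f i ℚ.+ g i) ≡ Σℚ f ℚ.+ Σℚ g
Σℚ-+ {zero}  f g = refl
Σℚ-+ {suc n} f g = ≡.trans (cong (f zero ℚ.+ g zero ℚ.+_) (Σℚ-+ (f ∘ suc) (g ∘ suc))) (ℚ+.interchange (f zero) (g zero) _ _)

Σℚ-*ˡ : ∀ {n} k (f : Fin n → ℚ) → Σℚ (λ i → k ℚ.* f i) ≡ k ℚ.* Σℚ f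
Σℚ-*ˡ {zero}  k f = ≡.sym (ℚₚ.*-zeroʳ k)
Σℚ-*ˡ {suc n} k f = ≡.trans (cong (k ℚ.* f zero ℚ.+_) (Σℚ-*ˡ k (f ∘ suc))) (≡.sym (ℚₚ.*-distribˡ-+ k _ _))

ℤ→ℚ-Σ : ∀ {n} (f : Fin n → ℤ) → ℤ→ℚ (Σℤ f) ≡ Σℚ (ℤ→ℚ ∘ f)
ℤ→ℚ-Σ {zero}  f = refl
ℤ→ℚ-Σ {suc n} f = ≡.trans (ℤ→ℚ-+ (f zero) _) (cong (ℤ→ℚ (f zero) ℚ.+_) (ℤ→ℚ-Σ (f ∘ suc)))

ℕ→ℚ-Σ : ∀ {n} (f : Fin n → ℕ) → ℕ→ℚ (Σℕ f) ≡ Σℚ (ℕ→ℚ ∘ f)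
ℕ→ℚ-Σ {zero}  f = refl
ℕ→ℚ-Σ {suc n} f = ≡.trans (ℤ→ℚ-+ (+ f zero) (+ Σℕ (f ∘ suc))) (cong (ℕ→ℚ (f zero) ℚ.+_) (ℕ→ℚ-Σ (f ∘ suc)))

if-float₀ : ∀ {A B : Set} (h : A → B) {a₀ b₀} → h a₀ ≡ b₀ → ∀ s {x} → h (if s then x else a₀) ≡ (if s then h x else b₀)
if-float₀ h h₀ s = ≡.trans (if-float h s) (if-cong-else s h₀)

if-distrib-+ : ∀ s (p q : ℚ) → (if s then p ℚ.+ q else 0ℚ) ≡ (if s then p else 0ℚ) ℚ.+ (if s then q else 0ℚ)
if-distrib-+ true  p q = refl
if-distrib-+ false p q = ≡.sym (ℚₚ.+-identityʳ 0ℚ)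

ℕ→ℚ-chipsOnℕ : ∀ {n} (S : Fin n → Bool) c → ℕ→ℚ (chipsOnℕ S c) ≡ Σℚ (λ v → if S v then ℕ→ℚ (c v) else 0ℚ)
ℕ→ℚ-chipsOnℕ S c = ≡.trans (ℕ→ℚ-Σ (λ v → if S v then c v else 0)) (Σℚ-cong λ v → if-float ℕ→ℚ (S v))

ℤ→ℚ-chipsOn : ∀ {n} (S : Fin n → Bool) x → ℤ→ℚ (chipsOn S x) ≡ Σℚ (λ v → if S v then ℤ→ℚ (x v) else 0ℚ)
ℤ→ℚ-chipsOn S x = ≡.trans (ℤ→ℚ-Σ (λ v → if S v then x v else + 0)) (Σℚ-cong λ v → if-float ℤ→ℚ (S v))

weighted : ∀ {n} → List (ℚ × Config n) → (Config n → ℚ) → ℚ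
weighted []            f = 0ℚ
weighted ((μ , c) ∷ L) f = μ ℚ.* f c ℚ.+ weighted L f

combo≡weighted : ∀ {n} (L : List (ℚ × Config n)) j → combo L j ≡ weighted L (λ c → ℕ→ℚ (c j))
combo≡weighted []            j = refl
combo≡weighted ((μ , c) ∷ L) j = cong (μ ℚ.* ℕ→ℚ (c j) ℚ.+_) (combo≡weighted L j)

weighted-≥ : ∀ {n} {f : Config n → ℚ} b L → All (λ p → 0ℚ ℚ.≤ proj₁ p × b ℚ.≤ f (proj₂ p)) L →
             b ℚ.* weights L ℚ.≤ weighted L f
weighted-≥ b [] [] = ℚₚ.≤-reflexive (ℚₚ.*-zeroʳ b)
weighted-≥ {f = f} b ((μ , c) ∷ L) ((μ≥0 , b≤fc) ∷ bounds) = begin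
  b ℚ.* (μ ℚ.+ weights L)       ≡⟨ ℚₚ.*-distribˡ-+ b μ (weights L) ⟩
  b ℚ.* μ ℚ.+ b ℚ.* weights L   ≡⟨ cong (ℚ._+ b ℚ.* weights L) (ℚₚ.*-comm b μ) ⟩
  μ ℚ.* b ℚ.+ b ℚ.* weights L   ≤⟨ ℚₚ.+-mono-≤ (ℚₚ.*-monoˡ-≤-nonNeg μ {{ℚ.nonNegative μ≥0}} b≤fc) (weighted-≥ b L bounds) ⟩
  μ ℚ.* f c ℚ.+ weighted L f    ∎
  where open ℚₚ.≤-Reasoning

convex-≥ : ∀ {n} {f : Config n → ℚ} b L → weights L ≡ 1ℚ → All (λ p → 0ℚ ℚ.≤ proj₁ p × b ℚ.≤ f (proj₂ p)) L →
           b ℚ.≤ weighted L f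
convex-≥ b L weights≡1 bounds =
  subst (ℚ._≤ _) (≡.trans (cong (b ℚ.*_) weights≡1) (ℚₚ.*-identityʳ b)) (weighted-≥ b L bounds)

Σℚ-restrict-combo : ∀ {n} (S : Fin n → Bool) L →
                    Σℚ (λ v → if S v then combo L v else 0ℚ) ≡ weighted L (λ c → ℕ→ℚ (chipsOnℕ S c))
Σℚ-restrict-combo S [] = Σℚ-zeros λ v → if-eta (S v)
Σℚ-restrict-combo S ((μ , c) ∷ L) = begin
  Σℚ (λ v → if S v then μ ℚ.* ℕ→ℚ (c v) ℚ.+ combo L v else 0ℚ)
    ≡⟨ Σℚ-cong (λ v → ≡.trans (if-distrib-+ (S v) _ _) (cong (ℚ._+ (if S v then combo L v else 0ℚ)) (≡.sym (if-float₀ (μ ℚ.*_) (ℚₚ.*-zeroʳ μ) (S v))))) ⟩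
  Σℚ (λ v → μ ℚ.* (if S v then ℕ→ℚ (c v) else 0ℚ) ℚ.+ (if S v then combo L v else 0ℚ))
    ≡⟨ Σℚ-+ (λ v → μ ℚ.* (if S v then ℕ→ℚ (c v) else 0ℚ)) (λ v → if S v then combo L v else 0ℚ) ⟩
  Σℚ (λ v → μ ℚ.* (if S v then ℕ→ℚ (c v) else 0ℚ)) ℚ.+ Σℚ (λ v → if S v then combo L v else 0ℚ)
    ≡⟨ cong₂ ℚ._+_ (≡.trans (Σℚ-*ˡ μ (λ v → if S v then ℕ→ℚ (c v) else 0ℚ)) (cong (μ ℚ.*_) (≡.sym (ℕ→ℚ-chipsOnℕ S c)))) (Σℚ-restrict-combo S L) ⟩
  μ ℚ.* ℕ→ℚ (chipsOnℕ S c) ℚ.+ weighted L (λ c → ℕ→ℚ (chipsOnℕ S c))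
    ∎
  where open ≡-Reasoning

chipsOn-dilated : ∀ {n} S (x : Fin n → ℤ) t L → (∀ j → ℤ→ℚ (x j) ≡ ℕ→ℚ t ℚ.* combo L j) →
                  ℤ→ℚ (chipsOn S x) ≡ ℕ→ℚ t ℚ.* weighted L (λ c → ℕ→ℚ (chipsOnℕ S c))
chipsOn-dilated S x t L x≡tL = begin
  ℤ→ℚ (chipsOn S x)
    ≡⟨ ℤ→ℚ-chipsOn S x ⟩
  Σℚ (λ v → if S v then ℤ→ℚ (x v) else 0ℚ)
    ≡⟨ Σℚ-cong (λ v → ≡.trans (if-cong-then (S v) (x≡tL v)) (≡.sym (if-float₀ (ℕ→ℚ t ℚ.*_) (ℚₚ.*-zeroʳ (ℕ→ℚ t)) (S v)))) ⟩
  Σℚ (λ v → ℕ→ℚ t ℚ.* (if S v then combo L v else 0ℚ))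
    ≡⟨ Σℚ-*ˡ (ℕ→ℚ t) (λ v → if S v then combo L v else 0ℚ) ⟩
  ℕ→ℚ t ℚ.* Σℚ (λ v → if S v then combo L v else 0ℚ)
    ≡⟨ cong (ℕ→ℚ t ℚ.*_) (Σℚ-restrict-combo S L) ⟩
  ℕ→ℚ t ℚ.* weighted L (λ c → ℕ→ℚ (chipsOnℕ S c))
    ∎
  where open ≡-Reasoning

lemma4p2 : (n : ℕ) → 1 ≤ n → (T : Graph n) → IsTree T → (ℓ : ℕ) → 1 ≤ ℓ → (t : ℕ) → 1 ≤ t → (x : Fin n → ℤ) → InDilatedP T ℓ t x → TDilated T t x
lemma4p2 n _ T (connected , _) ℓ _ t _ x (L , members , weights≡1 , x≡tL) = nonnegative , subtree-bound
  where
  open ℚₚ.≤-Reasoning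

  nonnegative : ∀ i → + 0 ℤ.≤ x i
  nonnegative i = ℤ→ℚ-cancel-≤ {+ 0} (begin
    0ℚ                                     ≡⟨ ≡.sym (ℚₚ.*-zeroʳ (ℕ→ℚ t)) ⟩
    ℕ→ℚ t ℚ.* 0ℚ                           ≤⟨ *-monoˡ-≤-ℕ→ℚ t (convex-≥ 0ℚ L weights≡1 (All.map (λ {p} (μ≥0 , _) → μ≥0 , 0≤ℕ→ℚ (proj₂ p i)) members)) ⟩
    ℕ→ℚ t ℚ.* weighted L (λ c → ℕ→ℚ (c i)) ≡⟨ cong (ℕ→ℚ t ℚ.*_) (≡.sym (combo≡weighted L i)) ⟩
    ℕ→ℚ t ℚ.* combo L i                    ≡⟨ ≡.sym (x≡tL i) ⟩
    ℤ→ℚ (x i)                              ∎)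

  subtree-bound : ∀ S → IsSubtree T S → + t ℤ.* (+ size S ℤ.- + 1) ℤ.≤ chipsOn S x
  subtree-bound S subtree = ℤ→ℚ-cancel-≤ (begin
    ℤ→ℚ (+ t ℤ.* (+ size S ℤ.- + 1))                ≡⟨ ≡.trans (ℤ→ℚ-* (+ t) (+ size S ℤ.- + 1)) (cong (λ m → ℕ→ℚ t ℚ.* ℤ→ℚ m) (ℤₚ.⊖-≥ (size-positive subtree))) ⟩
    ℕ→ℚ t ℚ.* ℕ→ℚ (size S ∸ 1)                      ≤⟨ *-monoˡ-≤-ℕ→ℚ t (convex-≥ _ L weights≡1 (All.map chips≥ members)) ⟩
    ℕ→ℚ t ℚ.* weighted L (λ c → ℕ→ℚ (chipsOnℕ S c)) ≡⟨ ≡.sym (chipsOn-dilated S x t L x≡tL) ⟩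
    ℤ→ℚ (chipsOn S x)                               ∎)
    where
    chips≥ : ∀ {p} → 0ℚ ℚ.≤ proj₁ p × InS T ℓ (proj₂ p) → 0ℚ ℚ.≤ proj₁ p × ℕ→ℚ (size S ∸ 1) ℚ.≤ ℕ→ℚ (chipsOnℕ S (proj₂ p))
    chips≥ (μ≥0 , selfReachable , _) = μ≥0 , ℕ→ℚ-mono-≤ (∸-monoˡ-≤ 1 (selfReachable⇒subtree-chips connected selfReachable subtree))
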